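{- There exists a constant $\delta > 0$ such that for every sufficiently large integer $n$ there exists a triangle-free $n$-vertex graph $G$ such that $\xi(\overline{G},\mathbb{F}_2) \leq n^{1-\delta}$.
   Context: $\overline{G}$ denotes the complement of $G$ and $\mathbb{F}_2$ the binary field. For a graph $H=(V,E)$ and a field $\mathbb{F}$, a $t$-dimensional orthogonal representation of $H$ over $\mathbb{F}$ is an assignment of a vector $u_v \in \mathbb{F}^t$ with $\langle u_v,u_v\rangle \neq 0$ to every vertex $v$, such that $\langle u_v,u_{v'}\rangle = 0$ whenever $v,v'$ are adjacent in $H$; $\xi(H,\mathbb{F})$ is the smallest such $t$. Here $\langle x,y\rangle=\sum_i x_iy_i$. -}

module Defs where

open import Data.Nat using (ℕ; zero; suc; _*_; _^_; _≤_; _<_)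
open import Data.Fin using (Fin) renaming (zero to fzero; suc to fsuc)
open import Data.Bool using (Bool; true; false; _xor_; _∧_)
open import Data.Product using (Σ; _×_; _,_; ∃-syntax)
open import Relation.Binary.PropositionalEquality using (_≡_; _≢_; refl) renaming (sym to ≡-sym)
open import Relation.Nullary using (¬_)

record Graph (n : ℕ) : Set₁ where
  field
    Adj   : Fin n → Fin n → Set
    sym   : ∀ {u v} → Adj u v → Adj v u
    irref : ∀ {u} → ¬ Adj u u
open Graph public

complement : ∀ {n} → Graph n → Graph n
complement G = record
  { Adj   = λ u v → (u ≢ v) × ¬ Adj G u v
  ; sym   = λ { (u≢v , ¬a) → (λ e → u≢v (≡-sym e)) , (λ a → ¬a (Graph.sym G a)) }
  ; irref = λ { (u≢u , _) → u≢u refl }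
  }

TriangleFree : ∀ {n} → Graph n → Set
TriangleFree G = ∀ u v w → ¬ (Adj G u v × Adj G v w × Adj G u w)

-- The binary field F₂ modelled as Bool: addition = xor, multiplication = ∧.
-- Vectors in F₂^t are functions Fin t → Bool.
sumF2 : ∀ {t} → (Fin t → Bool) → Bool
sumF2 {zero}  f = false
sumF2 {suc t} f = f fzero xor sumF2 (λ i → f (fsuc i))

inner : ∀ {t} → (Fin t → Bool) → (Fin t → Bool) → Bool
inner x y = sumF2 (λ i → x i ∧ y i)

record OrthRep {n : ℕ} (H : Graph n) (t : ℕ) : Set where
  field
    vec   : Fin n → Fin t → Bool
    nondeg : ∀ v → inner (vec v) (vec v) ≡ true
    orth  : ∀ {v v'} → Adj H v v' → inner (vec v) (vec v') ≡ false

ξ-F2-≤ : ∀ {n} → Graph n → ℕ → Set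
ξ-F2-≤ H T = ∃[ t ] (OrthRep H t × t ≤ T)

-- ξ(H, F₂) ≤ n^(1 - p/q), for rational exponent δ = p/q, written without reals:
-- ∃ t with a representation of dimension t and t^q · n^p ≤ n^q.
ξ-F2-≤-pow : ∀ {n} → Graph n → (p q : ℕ) → Set
ξ-F2-≤-pow {n} H p q = ∃[ t ] (OrthRep H t × (t ^ q) * (n ^ p) ≤ n ^ q)

-- Join two w-subsets of a k-set, w = 3H − 1 and k = 6H − 1 for H a power of two, when they meet
-- in exactly a = H − 1 points. Three pairwise adjacent sets would need at least 3w − 3a > k points, so the
-- graph is triangle-free. Sending A to the indicator vectors of its a-subsets and of its
-- (a + H)-subsets gives ⟨u_A, u_B⟩ = C(c, a) + C(c, a + H) mod 2 with c = |A ∩ B|, and by Lucas'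
-- theorem this is 1 for c = w and 0 for every other c ≠ a. This represents the complement over F₂
-- in dimension C(k, a) + C(k, a + H), exponentially smaller than the C(k, w) vertices; disjoint
-- copies of the graph for the largest H that fits then handle every n.
module Submission where

open import Algebra.Bundles using (CommutativeRing)
open import Data.Bool using (Bool; true; false; _xor_; _∧_)
open import Data.Bool.Properties
  using (xor-assoc; xor-same; xor-identityʳ; ∧-zeroʳ; xor-∧-commutativeRing)
open import Data.Empty using (⊥-elim)
open import Data.Fin as Fin using (Fin; zero; suc; splitAt; join; remQuot; combine; inject≤)
open import Data.Fin.Properties using (join-splitAt; combine-remQuot; inject≤-injective)
open import Data.Fin.Subset using (Subset; inside; outside; _∩_; ∣_∣) renaming (⊥ to ∅)
open import Data.Fin.Subset.Properties using (∣⊥∣≡0; ∣p∩q∣≤∣p∣; ∩-comm; ∩-idem)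
open import Data.Nat
  using (ℕ; zero; suc; _+_; _*_; _^_; _∸_; _/_; _≤_; _<_; z≤n; s≤s; s≤s⁻¹; z<s; _<?_; _≤?_; NonZero; >-nonZero)
open import Data.Nat.DivMod using (m≡m%n+[m/n]*n; m%n<n; m/n*n≤m)
open import Data.Nat.Properties
open import Data.Nat.Tactic.RingSolver using (solve-∀)
open import Data.Product using (Σ; _×_; _,_; proj₁; proj₂; uncurry; ∃-syntax)
open import Data.Sum using (inj₁; inj₂)
open import Data.Vec using ([]; _∷_)
open import Data.Vec.Functional using (Vector; _++_; map)
open import Data.Vec.Properties using (∷-injectiveˡ; ∷-injectiveʳ)
open import Function using (_∘_; const)
open import Function.Definitions using (Injective)
open import Relation.Binary.PropositionalEquality
open import Relation.Nullary using (yes; no; contradiction)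
open import Algebra.Properties.CommutativeSemigroup
  (CommutativeRing.+-commutativeSemigroup xor-∧-commutativeRing) using (interchange)
open import Algebra.Properties.CommutativeSemigroup *-commutativeSemigroup using (x∙yz≈y∙xz)

open import Defs hiding (sym)

-- Inner products over F₂

sumF2-cong : ∀ {t} {f g : Vector Bool t} → f ≗ g → sumF2 f ≡ sumF2 g
sumF2-cong {zero}  f≗g = refl
sumF2-cong {suc t} f≗g = cong₂ _xor_ (f≗g zero) (sumF2-cong (f≗g ∘ suc))

sumF2-zero : ∀ t → sumF2 {t} (const false) ≡ false
sumF2-zero zero    = refl
sumF2-zero (suc t) = sumF2-zero t

++-∘suc : ∀ {s t} (f : Vector Bool (suc s)) (g : Vector Bool t) →
          (f ++ g) ∘ suc ≗ (f ∘ suc) ++ g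
++-∘suc {s} f g i with splitAt s i
... | inj₁ _ = refl
... | inj₂ _ = refl

sumF2-++ : ∀ {s t} (f : Vector Bool s) (g : Vector Bool t) →
           sumF2 (f ++ g) ≡ sumF2 f xor sumF2 g
sumF2-++ {zero}  f g = refl
sumF2-++ {suc s} f g = begin
  f zero xor sumF2 ((f ++ g) ∘ suc)        ≡⟨ cong (f zero xor_) (sumF2-cong (++-∘suc f g)) ⟩
  f zero xor sumF2 ((f ∘ suc) ++ g)        ≡⟨ cong (f zero xor_) (sumF2-++ (f ∘ suc) g) ⟩
  f zero xor (sumF2 (f ∘ suc) xor sumF2 g) ≡⟨ xor-assoc (f zero) _ _ ⟨
  sumF2 f xor sumF2 g                      ∎
  where open ≡-Reasoning

∧-++ : ∀ {s t} (f f′ : Vector Bool s) (g g′ : Vector Bool t) i →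
       ((f ++ g) i ∧ (f′ ++ g′) i) ≡ ((λ j → f j ∧ f′ j) ++ (λ j → g j ∧ g′ j)) i
∧-++ {s} f f′ g g′ i with splitAt s i
... | inj₁ _ = refl
... | inj₂ _ = refl

inner-++ : ∀ {s t} (f f′ : Vector Bool s) (g g′ : Vector Bool t) →
           inner (f ++ g) (f′ ++ g′) ≡ inner f f′ xor inner g g′
inner-++ {s} f f′ g g′ = trans (sumF2-cong (∧-++ f f′ g g′)) (sumF2-++ {s} _ _)

inner-zeroˡ : ∀ {t} (f : Vector Bool t) → inner (const false) f ≡ false
inner-zeroˡ {t} f = sumF2-zero t

inner-zeroʳ : ∀ {t} (f : Vector Bool t) → inner f (const false) ≡ false
inner-zeroʳ {t} f = trans (sumF2-cong (∧-zeroʳ ∘ f)) (sumF2-zero t)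

inner-∧ : ∀ {t} x y (f g : Vector Bool t) →
          inner (map (x ∧_) f) (map (y ∧_) g) ≡ (x ∧ y) ∧ inner f g
inner-∧ true  true  f g = refl
inner-∧ true  false f g = inner-zeroʳ f
inner-∧ false y     f g = inner-zeroˡ (map (y ∧_) g)

block : ∀ M {t} → Fin M → Vector Bool t → Vector Bool (M * t)
block (suc M) zero    f = f ++ const false
block (suc M) (suc c) f = const false ++ block M c f

inner-block : ∀ M {t} (c : Fin M) (f g : Vector Bool t) →
              inner (block M c f) (block M c g) ≡ inner f g
inner-block (suc M) {t} zero    f g = begin
  inner (f ++ const false) (g ++ const false)
    ≡⟨ inner-++ f g (const false) (const false) ⟩
  inner f g xor inner {M * t} (const false) (const false)
    ≡⟨ cong (inner f g xor_) (inner-zeroˡ {M * t} (const false)) ⟩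
  inner f g xor false
    ≡⟨ xor-identityʳ _ ⟩
  inner f g ∎
  where open ≡-Reasoning
inner-block (suc M) {t} (suc c) f g =
  trans (inner-++ {t} (const false) (const false) _ _)
        (cong₂ _xor_ (inner-zeroˡ {t} (const false)) (inner-block M c f g))

inner-block-≢ : ∀ M {t} (c d : Fin M) (f g : Vector Bool t) → c ≢ d →
                inner (block M c f) (block M d g) ≡ false
inner-block-≢ (suc M)     zero    zero    f g c≢d = ⊥-elim (c≢d refl)
inner-block-≢ (suc M)     zero    (suc d) f g c≢d =
  trans (inner-++ f (const false) (const false) _) (cong₂ _xor_ (inner-zeroʳ f) (inner-zeroˡ (block M d g)))
inner-block-≢ (suc M)     (suc c) zero    f g c≢d =
  trans (inner-++ (const false) g _ (const false)) (cong₂ _xor_ (inner-zeroˡ g) (inner-zeroʳ (block M c f)))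
inner-block-≢ (suc M) {t} (suc c) (suc d) f g c≢d =
  trans (inner-++ {t} (const false) (const false) _ _)
        (cong₂ _xor_ (inner-zeroˡ {t} (const false)) (inner-block-≢ M c d f g (c≢d ∘ cong suc)))

-- Binomial coefficients mod 2 and Lucas' theorem

binomial₂ : ℕ → ℕ → Bool
binomial₂ m       zero    = true
binomial₂ zero    (suc j) = false
binomial₂ (suc m) (suc j) = binomial₂ m j xor binomial₂ m (suc j)

binomial₂-< : ∀ {m j} → m < j → binomial₂ m j ≡ false
binomial₂-< {zero}  {suc j} _         = refl
binomial₂-< {suc m} {suc j} (s≤s m<j) =
  cong₂ _xor_ (binomial₂-< m<j) (binomial₂-< (m≤n⇒m≤1+n m<j))

binomial₂-diag : ∀ m → binomial₂ m m ≡ true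
binomial₂-diag zero    = refl
binomial₂-diag (suc m) = cong₂ _xor_ (binomial₂-diag m) (binomial₂-< (n<1+n m))

-- Coefficient sequences of polynomials over F₂; shiftBy K f is x^K · f.
shiftBy : ℕ → (ℕ → Bool) → ℕ → Bool
shiftBy zero    f j       = f j
shiftBy (suc K) f zero    = false
shiftBy (suc K) f (suc j) = shiftBy K f j

shiftBy-< : ∀ K f {j} → j < K → shiftBy K f j ≡ false
shiftBy-< (suc K) f {zero}  _       = refl
shiftBy-< (suc K) f {suc j} (s≤s p) = shiftBy-< K f p

shiftBy-cong : ∀ K {f g} → f ≗ g → shiftBy K f ≗ shiftBy K g
shiftBy-cong zero    f≗g j       = f≗g j
shiftBy-cong (suc K) f≗g zero    = refl
shiftBy-cong (suc K) f≗g (suc j) = shiftBy-cong K f≗g j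

shiftBy-xor : ∀ K f g j → shiftBy K (λ i → f i xor g i) j ≡ shiftBy K f j xor shiftBy K g j
shiftBy-xor zero    f g j       = refl
shiftBy-xor (suc K) f g zero    = refl
shiftBy-xor (suc K) f g (suc j) = shiftBy-xor K f g j

shiftBy-+ : ∀ K L f j → shiftBy K (shiftBy L f) j ≡ shiftBy (K + L) f j
shiftBy-+ zero    L f j       = refl
shiftBy-+ (suc K) L f zero    = refl
shiftBy-+ (suc K) L f (suc j) = shiftBy-+ K L f j

shiftBy-pascal : ∀ K m j →
  shiftBy K (binomial₂ (suc m)) (suc j) ≡ shiftBy K (binomial₂ m) j xor shiftBy K (binomial₂ m) (suc j)
shiftBy-pascal zero          m j       = refl
shiftBy-pascal (suc zero)    m zero    = refl
shiftBy-pascal (suc (suc K)) m zero    = refl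
shiftBy-pascal (suc K)       m (suc j) = shiftBy-pascal K m j

-- (1 + x)^K = 1 + x^K over F₂; this holds exactly when K is a power of two.
Frobenius : ℕ → Set
Frobenius K = ∀ j → binomial₂ K j ≡ binomial₂ 0 j xor shiftBy K (binomial₂ 0) j

binomial₂-+ : ∀ {K} → Frobenius (suc K) →
              ∀ m j → binomial₂ (m + suc K) j ≡ binomial₂ m j xor shiftBy (suc K) (binomial₂ m) j
binomial₂-+       frob zero    j       = frob j
binomial₂-+       frob (suc m) zero    = refl
binomial₂-+ {K} frob (suc m) (suc j) = begin
  binomial₂ (m + suc K) j xor binomial₂ (m + suc K) (suc j)
    ≡⟨ cong₂ _xor_ (binomial₂-+ frob m j) (binomial₂-+ frob m (suc j)) ⟩
  (binomial₂ m j xor shiftBy (suc K) (binomial₂ m) j) xor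
  (binomial₂ m (suc j) xor shiftBy (suc K) (binomial₂ m) (suc j))
    ≡⟨ interchange (binomial₂ m j) _ (binomial₂ m (suc j)) _ ⟩
  binomial₂ (suc m) (suc j) xor
  (shiftBy (suc K) (binomial₂ m) j xor shiftBy (suc K) (binomial₂ m) (suc j))
    ≡⟨ cong (binomial₂ (suc m) (suc j) xor_) (shiftBy-pascal (suc K) m j) ⟨
  binomial₂ (suc m) (suc j) xor shiftBy (suc K) (binomial₂ (suc m)) (suc j) ∎
  where open ≡-Reasoning

binomial₂-+-low : ∀ {K} → Frobenius (suc K) → ∀ m {j} → j < suc K →
                  binomial₂ (m + suc K) j ≡ binomial₂ m j
binomial₂-+-low {K} frob m {j} j<K = begin
  binomial₂ (m + suc K) j                               ≡⟨ binomial₂-+ frob m j ⟩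
  binomial₂ m j xor shiftBy (suc K) (binomial₂ m) j     ≡⟨ cong (binomial₂ m j xor_) (shiftBy-< (suc K) _ j<K) ⟩
  binomial₂ m j xor false                               ≡⟨ xor-identityʳ _ ⟩
  binomial₂ m j                                         ∎
  where open ≡-Reasoning

xor-cancel-middle : ∀ x y z → (x xor y) xor (y xor z) ≡ x xor z
xor-cancel-middle x y z = begin
  (x xor y) xor (y xor z) ≡⟨ xor-assoc x y (y xor z) ⟩
  x xor (y xor (y xor z)) ≡⟨ cong (x xor_) (xor-assoc y y z) ⟨
  x xor ((y xor y) xor z) ≡⟨ cong (λ u → x xor (u xor z)) (xor-same y) ⟩
  x xor z                 ∎
  where open ≡-Reasoning

Frobenius-double : ∀ {K} → Frobenius (suc K) → Frobenius (suc K + suc K)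
Frobenius-double {K} frob j = begin
  binomial₂ (suc K + suc K) j
    ≡⟨ binomial₂-+ frob (suc K) j ⟩
  binomial₂ (suc K) j xor shiftBy (suc K) (binomial₂ (suc K)) j
    ≡⟨ cong₂ _xor_ (frob j) (shiftBy-cong (suc K) frob j) ⟩
  (one j xor x^K j) xor shiftBy (suc K) (λ i → one i xor x^K i) j
    ≡⟨ cong ((one j xor x^K j) xor_) (shiftBy-xor (suc K) one x^K j) ⟩
  (one j xor x^K j) xor (x^K j xor shiftBy (suc K) x^K j)
    ≡⟨ cong (λ u → (one j xor x^K j) xor (x^K j xor u)) (shiftBy-+ (suc K) (suc K) one j) ⟩
  (one j xor x^K j) xor (x^K j xor shiftBy (suc K + suc K) one j)
    ≡⟨ xor-cancel-middle (one j) (x^K j) _ ⟩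
  one j xor shiftBy (suc K + suc K) one j ∎
  where
  open ≡-Reasoning
  one = binomial₂ 0
  x^K = shiftBy (suc K) one

Frobenius-1 : Frobenius 1
Frobenius-1 zero          = refl
Frobenius-1 (suc zero)    = refl
Frobenius-1 (suc (suc j)) = refl

mersenne : ℕ → ℕ
mersenne zero    = zero
mersenne (suc s) = suc (mersenne s + mersenne s)

Frobenius-mersenne : ∀ s → Frobenius (suc (mersenne s))
Frobenius-mersenne zero    = Frobenius-1
Frobenius-mersenne (suc s) =
  subst Frobenius (cong suc (+-suc (mersenne s) (mersenne s))) (Frobenius-double (Frobenius-mersenne s))

-- ⟨u_A, u_B⟩ in the construction below, as a function of c = |A ∩ B|
innerParity : ℕ → ℕ → Bool
innerParity a c = binomial₂ c a xor binomial₂ c (a + suc a)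

module _ {a : ℕ} (frob : Frobenius (suc a)) where

  innerParity-low : ∀ {m} → m < suc a → innerParity a m ≡ binomial₂ m a
  innerParity-low {m} m<H =
    trans (cong (binomial₂ m a xor_) (binomial₂-< (≤-trans m<H (m≤n+m (suc a) a))))
          (xor-identityʳ _)

  innerParity-middle : ∀ {m} → m ≤ a → innerParity a (m + suc a) ≡ false
  innerParity-middle {m} m≤a with m≤n⇒m<n∨m≡n m≤a
  ... | inj₁ m<a = cong₂ _xor_ (trans (binomial₂-+-low frob m (n<1+n a)) (binomial₂-< m<a))
                               (binomial₂-< (+-monoˡ-< (suc a) m<a))
  ... | inj₂ refl = begin
    binomial₂ (a + suc a) a xor binomial₂ (a + suc a) (a + suc a)
      ≡⟨ cong₂ _xor_ (binomial₂-+-low frob a (n<1+n a)) (binomial₂-diag (a + suc a)) ⟩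
    binomial₂ a a xor true
      ≡⟨ cong (_xor true) (binomial₂-diag a) ⟩
    false ∎
    where open ≡-Reasoning

  innerParity-high : ∀ {m} → m < suc a → innerParity a (m + (suc a + suc a)) ≡ binomial₂ m a
  innerParity-high {m} m<H = begin
    binomial₂ (m + (suc a + suc a)) a xor binomial₂ (m + (suc a + suc a)) (a + suc a)
      ≡⟨ cong₂ _xor_ (binomial₂-+-low frob₂ m (s≤s (m≤m+n a (suc a))))
                     (binomial₂-+-low frob₂ m (n<1+n (a + suc a))) ⟩
    binomial₂ m a xor binomial₂ m (a + suc a)
      ≡⟨ innerParity-low m<H ⟩
    binomial₂ m a ∎
    where
    open ≡-Reasoning
    frob₂ : Frobenius (suc a + suc a)
    frob₂ = Frobenius-double frob

  innerParity-top : innerParity a (a + (suc a + suc a)) ≡ true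
  innerParity-top = trans (innerParity-high (n<1+n a)) (binomial₂-diag a)

  -- c lies in [0, H), [H, 2H) or [2H, 3H − 1), where H = a + 1
  innerParity-below : ∀ {c} → c < a + (suc a + suc a) → c ≢ a → innerParity a c ≡ false
  innerParity-below {c} c<w c≢a with c <? suc a
  ... | yes c<H = trans (innerParity-low c<H) (binomial₂-< (≤∧≢⇒< (s≤s⁻¹ c<H) c≢a))
  ... | no c≮H with c ∸ suc a <? suc a
  ...   | yes m<H = subst (λ x → innerParity a x ≡ false) c-m+H≡c (innerParity-middle (s≤s⁻¹ m<H))
    where c-m+H≡c = m∸n+n≡m (≮⇒≥ c≮H)
  ...   | no m≮H = subst (λ x → innerParity a x ≡ false) c≡m+2H
                     (trans (innerParity-high (≤-trans m<a (n≤1+n a))) (binomial₂-< m<a))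
    where
    m = c ∸ suc a ∸ suc a
    c≡m+2H : m + (suc a + suc a) ≡ c
    c≡m+2H = begin
      m + (suc a + suc a)   ≡⟨ +-assoc m (suc a) (suc a) ⟨
      m + suc a + suc a     ≡⟨ cong (_+ suc a) (m∸n+n≡m (≮⇒≥ m≮H)) ⟩
      c ∸ suc a + suc a     ≡⟨ m∸n+n≡m (≮⇒≥ c≮H) ⟩
      c                     ∎
      where open ≡-Reasoning
    m<a : m < a
    m<a = +-cancelʳ-< (suc a + suc a) m a (subst (_< a + (suc a + suc a)) (sym c≡m+2H) c<w)

-- Subsets of a finite set and their indicator vectors

binomial : ℕ → ℕ → ℕ
binomial k       zero    = 1
binomial zero    (suc r) = 0
binomial (suc k) (suc r) = binomial k r + binomial k (suc r)

subsetsOfSize : ∀ k r → Vector (Subset k) (binomial k r)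
subsetsOfSize k       zero    = const ∅
subsetsOfSize zero    (suc r) = λ ()
subsetsOfSize (suc k) (suc r) =
  map (inside ∷_) (subsetsOfSize k r) ++ map (outside ∷_) (subsetsOfSize k (suc r))

∣subsetsOfSize∣ : ∀ k r i → ∣ subsetsOfSize k r i ∣ ≡ r
∣subsetsOfSize∣ k       zero    i = ∣⊥∣≡0 k
∣subsetsOfSize∣ (suc k) (suc r) i with splitAt (binomial k r) i
... | inj₁ j = cong suc (∣subsetsOfSize∣ k r j)
... | inj₂ j = ∣subsetsOfSize∣ k (suc r) j

splitAt-injective : ∀ m {n} {i j : Fin (m + n)} → splitAt m i ≡ splitAt m j → i ≡ j
splitAt-injective m {n} {i} {j} eq =
  trans (sym (join-splitAt m n i)) (trans (cong (join m n) eq) (join-splitAt m n j))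

subsetsOfSize-injective : ∀ k r {i j} → subsetsOfSize k r i ≡ subsetsOfSize k r j → i ≡ j
subsetsOfSize-injective k       zero    {zero} {zero} _ = refl
subsetsOfSize-injective (suc k) (suc r) {i} {j} eq
  with splitAt (binomial k r) i in eqᵢ | splitAt (binomial k r) j in eqⱼ
... | inj₁ i′ | inj₁ j′ = splitAt-injective (binomial k r)
  (trans eqᵢ (trans (cong inj₁ (subsetsOfSize-injective k r (∷-injectiveʳ eq))) (sym eqⱼ)))
... | inj₂ i′ | inj₂ j′ = splitAt-injective (binomial k r)
  (trans eqᵢ (trans (cong inj₂ (subsetsOfSize-injective k (suc r) (∷-injectiveʳ eq))) (sym eqⱼ)))
... | inj₁ _  | inj₂ _  with () ← ∷-injectiveˡ eq
... | inj₂ _  | inj₁ _  with () ← ∷-injectiveˡ eq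

-- Coordinates are the r-subsets S in the order of subsetsOfSize; the entry at S is [S ⊆ A].
subsetIndicator : ∀ {k} r → Subset k → Vector Bool (binomial k r)
subsetIndicator         zero    A       = const true
subsetIndicator {zero}  (suc r) []      = λ ()
subsetIndicator {suc k} (suc r) (x ∷ A) =
  map (x ∧_) (subsetIndicator r A) ++ subsetIndicator (suc r) A

inner-subsetIndicator : ∀ {k} r (A B : Subset k) →
  inner (subsetIndicator r A) (subsetIndicator r B) ≡ binomial₂ ∣ A ∩ B ∣ r
inner-subsetIndicator         zero    A       B       = refl
inner-subsetIndicator {zero}  (suc r) []      []      = refl
inner-subsetIndicator {suc k} (suc r) (x ∷ A) (y ∷ B) = begin
  inner (map (x ∧_) (subsetIndicator r A) ++ subsetIndicator (suc r) A)
        (map (y ∧_) (subsetIndicator r B) ++ subsetIndicator (suc r) B)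
    ≡⟨ inner-++ (map (x ∧_) (subsetIndicator r A)) _ _ _ ⟩
  inner (map (x ∧_) (subsetIndicator r A)) (map (y ∧_) (subsetIndicator r B)) xor
  inner (subsetIndicator (suc r) A) (subsetIndicator (suc r) B)
    ≡⟨ cong₂ _xor_ (inner-∧ x y (subsetIndicator r A) (subsetIndicator r B)) (inner-subsetIndicator (suc r) A B) ⟩
  ((x ∧ y) ∧ inner (subsetIndicator r A) (subsetIndicator r B)) xor binomial₂ c (suc r)
    ≡⟨ cong (λ u → ((x ∧ y) ∧ u) xor binomial₂ c (suc r)) (inner-subsetIndicator r A B) ⟩
  ((x ∧ y) ∧ binomial₂ c r) xor binomial₂ c (suc r)
    ≡⟨ pascal (x ∧ y) ⟩
  binomial₂ ∣ (x ∧ y) ∷ (A ∩ B) ∣ (suc r) ∎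
  where
  open ≡-Reasoning
  c = ∣ A ∩ B ∣
  pascal : ∀ z → (z ∧ binomial₂ c r) xor binomial₂ c (suc r) ≡ binomial₂ ∣ z ∷ (A ∩ B) ∣ (suc r)
  pascal true  = refl
  pascal false = refl

∣x∷p∣≡∣x∣+∣p∣ : ∀ x {n} (p : Subset n) → ∣ x ∷ p ∣ ≡ ∣ x ∷ [] ∣ + ∣ p ∣
∣x∷p∣≡∣x∣+∣p∣ true  p = refl
∣x∷p∣≡∣x∣+∣p∣ false p = refl

∣p∣+∣q∣+∣r∣≤n+∣p∩q∣+∣q∩r∣+∣p∩r∣ : ∀ {n} (p q r : Subset n) →
  ∣ p ∣ + ∣ q ∣ + ∣ r ∣ ≤ n + (∣ p ∩ q ∣ + ∣ q ∩ r ∣ + ∣ p ∩ r ∣)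
∣p∣+∣q∣+∣r∣≤n+∣p∩q∣+∣q∩r∣+∣p∩r∣ [] [] [] = z≤n
∣p∣+∣q∣+∣r∣≤n+∣p∩q∣+∣q∩r∣+∣p∩r∣ {suc n} (x ∷ p) (y ∷ q) (z ∷ r) = begin
  ∣ x ∷ p ∣ + ∣ y ∷ q ∣ + ∣ z ∷ r ∣
    ≡⟨ cong₂ _+_ (cong₂ _+_ (∣x∷p∣≡∣x∣+∣p∣ x p) (∣x∷p∣≡∣x∣+∣p∣ y q)) (∣x∷p∣≡∣x∣+∣p∣ z r) ⟩
  (one x + ∣ p ∣) + (one y + ∣ q ∣) + (one z + ∣ r ∣)
    ≡⟨ regroup (one x) (one y) (one z) (∣ p ∣) (∣ q ∣) (∣ r ∣) ⟩
  (one x + one y + one z) + (∣ p ∣ + ∣ q ∣ + ∣ r ∣)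
    ≤⟨ +-mono-≤ (heads x y z) (∣p∣+∣q∣+∣r∣≤n+∣p∩q∣+∣q∩r∣+∣p∩r∣ p q r) ⟩
  (1 + (one (x ∧ y) + one (y ∧ z) + one (x ∧ z))) + (n + (∣ p ∩ q ∣ + ∣ q ∩ r ∣ + ∣ p ∩ r ∣))
    ≡⟨ regroup′ (one (x ∧ y)) (one (y ∧ z)) (one (x ∧ z)) n (∣ p ∩ q ∣) (∣ q ∩ r ∣) (∣ p ∩ r ∣) ⟩
  suc n + ((one (x ∧ y) + ∣ p ∩ q ∣) + (one (y ∧ z) + ∣ q ∩ r ∣) + (one (x ∧ z) + ∣ p ∩ r ∣))
    ≡⟨ cong (suc n +_) (cong₂ _+_ (cong₂ _+_ (∣x∷p∣≡∣x∣+∣p∣ (x ∧ y) (p ∩ q)) (∣x∷p∣≡∣x∣+∣p∣ (y ∧ z) (q ∩ r)))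
                                  (∣x∷p∣≡∣x∣+∣p∣ (x ∧ z) (p ∩ r))) ⟨
  suc n + (∣ (x ∷ p) ∩ (y ∷ q) ∣ + ∣ (y ∷ q) ∩ (z ∷ r) ∣ + ∣ (x ∷ p) ∩ (z ∷ r) ∣) ∎
  where
  open ≤-Reasoning
  one : Bool → ℕ
  one b = ∣ b ∷ [] ∣
  regroup : ∀ u v w p q r → (u + p) + (v + q) + (w + r) ≡ (u + v + w) + (p + q + r)
  regroup = solve-∀
  regroup′ : ∀ u v w n p q r → (1 + (u + v + w)) + (n + (p + q + r)) ≡ suc n + ((u + p) + (v + q) + (w + r))
  regroup′ = solve-∀
  heads : ∀ x y z → one x + one y + one z ≤ 1 + (one (x ∧ y) + one (y ∧ z) + one (x ∧ z))
  heads true  true  true  = ≤ᵇ⇒≤ 3 4 _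
  heads true  true  false = ≤-refl
  heads true  false true  = ≤-refl
  heads true  false false = ≤-refl
  heads false true  true  = ≤-refl
  heads false true  false = ≤-refl
  heads false false true  = ≤-refl
  heads false false false = z≤n

∣p∩q∣≡∣p∣⇒p∩q≡p : ∀ {n} (p q : Subset n) → ∣ p ∩ q ∣ ≡ ∣ p ∣ → p ∩ q ≡ p
∣p∩q∣≡∣p∣⇒p∩q≡p []            []            _  = refl
∣p∩q∣≡∣p∣⇒p∩q≡p (true  ∷ p) (true  ∷ q) eq = cong (true ∷_) (∣p∩q∣≡∣p∣⇒p∩q≡p p q (suc-injective eq))
∣p∩q∣≡∣p∣⇒p∩q≡p (true  ∷ p) (false ∷ q) eq = contradiction (∣p∩q∣≤∣p∣ p q) (<⇒≱ (≤-reflexive (sym eq)))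
∣p∩q∣≡∣p∣⇒p∩q≡p (false ∷ p) (y     ∷ q) eq = cong (false ∷_) (∣p∩q∣≡∣p∣⇒p∩q≡p p q eq)

∣p∩q∣≡∣p∣≡∣q∣⇒p≡q : ∀ {n} (p q : Subset n) → ∣ p ∣ ≡ ∣ q ∣ → ∣ p ∩ q ∣ ≡ ∣ p ∣ → p ≡ q
∣p∩q∣≡∣p∣≡∣q∣⇒p≡q p q ∣p∣≡∣q∣ full = begin
  p      ≡⟨ ∣p∩q∣≡∣p∣⇒p∩q≡p p q full ⟨
  p ∩ q  ≡⟨ ∩-comm p q ⟩
  q ∩ p  ≡⟨ ∣p∩q∣≡∣p∣⇒p∩q≡p q p (trans (cong ∣_∣ (∩-comm q p)) (trans full ∣p∣≡∣q∣)) ⟩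
  q      ∎
  where open ≡-Reasoning

-- The intersection graph

∣subsetsOfSize∩self∣ : ∀ k w i → ∣ subsetsOfSize k w i ∩ subsetsOfSize k w i ∣ ≡ w
∣subsetsOfSize∩self∣ k w i = trans (cong ∣_∣ (∩-idem (subsetsOfSize k w i))) (∣subsetsOfSize∣ k w i)

∣subsetsOfSize∩∣< : ∀ k w {i j} → i ≢ j → ∣ subsetsOfSize k w i ∩ subsetsOfSize k w j ∣ < w
∣subsetsOfSize∩∣< k w {i} {j} i≢j =
  ≤∧≢⇒< (subst (∣ S i ∩ S j ∣ ≤_) (∣S∣ i) (∣p∩q∣≤∣p∣ (S i) (S j)))
        (λ full → i≢j (subsetsOfSize-injective k w
           (∣p∩q∣≡∣p∣≡∣q∣⇒p≡q (S i) (S j) (trans (∣S∣ i) (sym (∣S∣ j))) (trans full (sym (∣S∣ i))))))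
  where
  S = subsetsOfSize k w
  ∣S∣ = ∣subsetsOfSize∣ k w

intersectionGraph : ∀ k w a → a < w → Graph (binomial k w)
intersectionGraph k w a a<w = record
  { Adj   = λ i j → ∣ S i ∩ S j ∣ ≡ a
  ; sym   = λ {i} {j} eq → trans (cong ∣_∣ (∩-comm (S j) (S i))) eq
  ; irref = λ {i} eq → <⇒≢ a<w (trans (sym eq) (∣subsetsOfSize∩self∣ k w i))
  }
  where
  S = subsetsOfSize k w

intersectionGraph-triangleFree : ∀ k w a (a<w : a < w) → k + (a + a + a) < w + w + w →
                                 TriangleFree (intersectionGraph k w a a<w)
intersectionGraph-triangleFree k w a a<w small u v x (uv , vx , ux) = <⇒≱ small (begin
  w + w + w
    ≡⟨ cong₂ _+_ (cong₂ _+_ (∣S∣ u) (∣S∣ v)) (∣S∣ x) ⟨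
  ∣ S u ∣ + ∣ S v ∣ + ∣ S x ∣
    ≤⟨ ∣p∣+∣q∣+∣r∣≤n+∣p∩q∣+∣q∩r∣+∣p∩r∣ (S u) (S v) (S x) ⟩
  k + (∣ S u ∩ S v ∣ + ∣ S v ∩ S x ∣ + ∣ S u ∩ S x ∣)
    ≡⟨ cong (k +_) (cong₂ _+_ (cong₂ _+_ uv vx) ux) ⟩
  k + (a + a + a) ∎)
  where
  open ≤-Reasoning
  S = subsetsOfSize k w
  ∣S∣ = ∣subsetsOfSize∣ k w

module Construction (a : ℕ) where

  H w k N T : ℕ
  H = suc a
  w = a + (H + H)
  k = w + (H + (H + H))
  N = binomial k w
  T = binomial k a + binomial k (a + H)

  a<w : a < w
  a<w = m<m+n a z<s

  2w<k : 2 * w < k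
  2w<k = ≤-reflexive (k≡2w+1 a)
    where
    k≡2w+1 : ∀ a → let H = suc a; w = a + (H + H) in suc (2 * w) ≡ w + (H + (H + H))
    k≡2w+1 = solve-∀

  graph : Graph N
  graph = intersectionGraph k w a a<w

  graph-triangleFree : TriangleFree graph
  graph-triangleFree = intersectionGraph-triangleFree k w a a<w (≤-reflexive (count a))
    where
    count : ∀ a → let H = suc a; w = a + (H + H) in
            suc (w + (H + (H + H)) + (a + a + a)) ≡ w + w + w
    count = solve-∀

  S : Fin N → Subset k
  S = subsetsOfSize k w

  vec : Fin N → Vector Bool T
  vec i = subsetIndicator a (S i) ++ subsetIndicator (a + H) (S i)

  inner-vec : ∀ i j → inner (vec i) (vec j) ≡ innerParity a ∣ S i ∩ S j ∣
  inner-vec i j = trans (inner-++ (subsetIndicator a (S i)) _ _ _)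
    (cong₂ _xor_ (inner-subsetIndicator a (S i) (S j)) (inner-subsetIndicator (a + H) (S i) (S j)))

  graph-orthRep : Frobenius H → OrthRep (complement graph) T
  graph-orthRep frob = record
    { vec    = vec
    ; nondeg = λ i → trans (inner-vec i i)
        (subst (λ c → innerParity a c ≡ true) (sym (∣subsetsOfSize∩self∣ k w i)) (innerParity-top frob))
    ; orth   = λ {i} {j} (i≢j , ¬adj) → trans (inner-vec i j)
        (innerParity-below frob (∣subsetsOfSize∩∣< k w i≢j) ¬adj)
    }

-- Induced subgraphs and disjoint copies

induced : ∀ {m n} → (Fin m → Fin n) → Graph n → Graph m
induced ι G = record
  { Adj   = λ u v → Adj G (ι u) (ι v)
  ; sym   = Graph.sym G
  ; irref = irref G
  }

induced-triangleFree : ∀ {m n} (ι : Fin m → Fin n) {G} → TriangleFree G → TriangleFree (induced ι G)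
induced-triangleFree ι tf u v x = tf (ι u) (ι v) (ι x)

induced-orthRep : ∀ {m n t} {ι : Fin m → Fin n} {G} → Injective _≡_ _≡_ ι →
                  OrthRep (complement G) t → OrthRep (complement (induced ι G)) t
induced-orthRep {ι = ι} ι-inj ρ = record
  { vec    = vec ∘ ι
  ; nondeg = nondeg ∘ ι
  ; orth   = λ (u≢v , ¬adj) → orth ((u≢v ∘ ι-inj) , ¬adj)
  }
  where open OrthRep ρ

module _ (M : ℕ) {N : ℕ} where

  private
    copy : Fin (M * N) → Fin M
    copy i = proj₁ (remQuot {M} N i)
    vertex : Fin (M * N) → Fin N
    vertex i = proj₂ (remQuot {M} N i)

  copies : Graph N → Graph (M * N)
  copies G = record
    { Adj   = λ i j → copy i ≡ copy j × Adj G (vertex i) (vertex j)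
    ; sym   = λ (same , adj) → sym same , Graph.sym G adj
    ; irref = λ (_ , adj) → irref G adj
    }

  copies-triangleFree : ∀ {G} → TriangleFree G → TriangleFree (copies G)
  copies-triangleFree tf i j l ((_ , ij) , (_ , jl) , (_ , il)) = tf (vertex i) (vertex j) (vertex l) (ij , jl , il)

  copies-orthRep : ∀ {G t} → OrthRep (complement G) t → OrthRep (complement (copies G)) (M * t)
  copies-orthRep {G} ρ = record
    { vec    = λ i → block M (copy i) (vec (vertex i))
    ; nondeg = λ i → trans (inner-block M (copy i) _ _) (nondeg (vertex i))
    ; orth   = λ {i} {j} → orth′ i j
    }
    where
    open OrthRep ρ
    orth′ : ∀ i j → Adj (complement (copies G)) i j →
            inner (block M (copy i) (vec (vertex i))) (block M (copy j) (vec (vertex j))) ≡ false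
    orth′ i j (i≢j , ¬adj) with copy i Fin.≟ copy j
    ... | no  c≢c′ = inner-block-≢ M (copy i) (copy j) _ _ c≢c′
    ... | yes c≡c′ = trans (cong (λ c → inner (block M c _) _) c≡c′)
                           (trans (inner-block M (copy j) _ _) (orth (v≢v′ , λ adj → ¬adj (c≡c′ , adj))))
      where
      v≢v′ : vertex i ≢ vertex j
      v≢v′ v≡v′ = i≢j (begin
        i                                  ≡⟨ combine-remQuot {M} N i ⟨
        uncurry combine (remQuot {M} N i)  ≡⟨ cong (uncurry combine) (cong₂ _,_ c≡c′ v≡v′) ⟩
        uncurry combine (remQuot {M} N j)  ≡⟨ combine-remQuot {M} N j ⟩
        j                                  ∎)
        where open ≡-Reasoning

subgraphOfCopies : ∀ {N t} {G : Graph N} n M → n ≤ M * N → TriangleFree G → OrthRep (complement G) t →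
                   Σ (Graph n) λ G′ → TriangleFree G′ × OrthRep (complement G′) (M * t)
subgraphOfCopies {G = G} n M n≤MN tf ρ =
  induced ι (copies M G) ,
  induced-triangleFree ι {G = copies M G} (copies-triangleFree M {G = G} tf) ,
  induced-orthRep {ι = ι} {G = copies M G} (inject≤-injective n≤MN n≤MN _ _) (copies-orthRep M {G = G} ρ)
  where
  ι : Fin n → Fin (M * _)
  ι u = inject≤ u n≤MN

-- Estimates

-- (j + 1)·C(k, j + 1) = (k − j)·C(k, j), with the subtraction moved across
binomial-step : ∀ k j → binomial k (suc j) * suc j + binomial k j * j ≡ k * binomial k j
binomial-step zero    zero    = refl
binomial-step zero    (suc j) = refl
binomial-step (suc k) zero    = cong suc (binomial-step k zero)
binomial-step (suc k) (suc j) = begin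
  (c₁ + c₂) * suc (suc j) + (c₀ + c₁) * suc j
    ≡⟨ regroup c₀ c₁ c₂ j ⟩
  (c₂ * suc (suc j) + c₁ * suc j) + (c₁ * suc j + c₀ * j) + c₁ + c₀
    ≡⟨ cong (λ u → u + c₁ + c₀) (cong₂ _+_ (binomial-step k (suc j)) (binomial-step k j)) ⟩
  k * c₁ + k * c₀ + c₁ + c₀
    ≡⟨ regroup′ k c₀ c₁ ⟩
  suc k * (c₀ + c₁) ∎
  where
  open ≡-Reasoning
  c₀ = binomial k j
  c₁ = binomial k (suc j)
  c₂ = binomial k (suc (suc j))
  regroup : ∀ c₀ c₁ c₂ j → (c₁ + c₂) * suc (suc j) + (c₀ + c₁) * suc j
                           ≡ (c₂ * suc (suc j) + c₁ * suc j) + (c₁ * suc j + c₀ * j) + c₁ + c₀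
  regroup = solve-∀
  regroup′ : ∀ k c₀ c₁ → k * c₁ + k * c₀ + c₁ + c₀ ≡ suc k * (c₀ + c₁)
  regroup′ = solve-∀

binomial-≤-suc : ∀ k j → 2 * j < k → binomial k j ≤ binomial k (suc j)
binomial-≤-suc k j 2j<k = *-cancelʳ-≤ (binomial k j) (binomial k (suc j)) (suc j)
  (+-cancelʳ-≤ (binomial k j * j) _ _ (begin
    binomial k j * suc j + binomial k j * j   ≡⟨ regroup (binomial k j) j ⟩
    suc (2 * j) * binomial k j                ≤⟨ *-monoˡ-≤ (binomial k j) 2j<k ⟩
    k * binomial k j                          ≡⟨ binomial-step k j ⟨
    binomial k (suc j) * suc j + binomial k j * j ∎))
  where
  open ≤-Reasoning
  regroup : ∀ c j → c * suc j + c * j ≡ suc (2 * j) * c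
  regroup = solve-∀

binomial-monoʳ-≤ : ∀ k {j j′} → j ≤ j′ → 2 * j′ < k → binomial k j ≤ binomial k j′
binomial-monoʳ-≤ k {j′ = zero}   z≤n _ = ≤-refl
binomial-monoʳ-≤ k {j′ = suc j′} j≤ 2j′<k with m≤n⇒m<n∨m≡n j≤
... | inj₂ refl     = ≤-refl
... | inj₁ j<suc-j′ = ≤-trans (binomial-monoʳ-≤ k (s≤s⁻¹ j<suc-j′) 2j<k)
                              (binomial-≤-suc k j′ 2j<k)
  where
  2j<k : 2 * j′ < k
  2j<k = ≤-trans (s≤s (*-monoʳ-≤ 2 (n≤1+n j′))) 2j′<k

binomial-ratio-step : ∀ k j → 12 * j + 7 ≤ 5 * k → 7 * binomial k j ≤ 5 * binomial k (suc j)
binomial-ratio-step k j small = *-cancelʳ-≤ (7 * binomial k j) (5 * binomial k (suc j)) (suc j)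
  (+-cancelʳ-≤ (5 * (binomial k j * j)) _ _ (begin
    7 * binomial k j * suc j + 5 * (binomial k j * j)
      ≡⟨ regroup (binomial k j) j ⟩
    (12 * j + 7) * binomial k j
      ≤⟨ *-monoˡ-≤ (binomial k j) small ⟩
    5 * k * binomial k j
      ≡⟨ trans (*-assoc 5 k _) (cong (5 *_) (sym (binomial-step k j))) ⟩
    5 * (binomial k (suc j) * suc j + binomial k j * j)
      ≡⟨ regroup′ (binomial k (suc j)) (binomial k j) j ⟩
    5 * binomial k (suc j) * suc j + 5 * (binomial k j * j) ∎))
  where
  open ≤-Reasoning
  regroup : ∀ c j → 7 * c * suc j + 5 * (c * j) ≡ (12 * j + 7) * c
  regroup = solve-∀
  regroup′ : ∀ c′ c j → 5 * (c′ * suc j + c * j) ≡ 5 * c′ * suc j + 5 * (c * j)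
  regroup′ = solve-∀

binomial-ratio : ∀ k j d → 12 * (j + d) ≤ 5 * k + 5 → 7 ^ d * binomial k j ≤ 5 ^ d * binomial k (j + d)
binomial-ratio k j zero    _     = ≤-reflexive (cong (λ i → binomial k i + 0) (sym (+-identityʳ j)))
binomial-ratio k j (suc d) small = begin
  7 * 7 ^ d * binomial k j            ≡⟨ *-assoc 7 (7 ^ d) _ ⟩
  7 * (7 ^ d * binomial k j)          ≤⟨ *-monoʳ-≤ 7 (binomial-ratio k j d small′) ⟩
  7 * (5 ^ d * binomial k (j + d))    ≡⟨ x∙yz≈y∙xz 7 (5 ^ d) _ ⟩
  5 ^ d * (7 * binomial k (j + d))    ≤⟨ *-monoʳ-≤ (5 ^ d) (binomial-ratio-step k (j + d) step) ⟩
  5 ^ d * (5 * binomial k (suc (j + d))) ≡⟨ x∙yz≈y∙xz (5 ^ d) 5 _ ⟩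
  5 * (5 ^ d * binomial k (suc (j + d))) ≡⟨ *-assoc 5 (5 ^ d) _ ⟨
  5 * 5 ^ d * binomial k (suc (j + d))   ≡⟨ cong (λ i → 5 * 5 ^ d * binomial k i) (+-suc j d) ⟨
  5 * 5 ^ d * binomial k (j + suc d)     ∎
  where
  open ≤-Reasoning
  unfold : ∀ j d → 12 * (j + suc d) ≡ (12 * (j + d) + 7) + 5
  unfold = solve-∀
  step : 12 * (j + d) + 7 ≤ 5 * k
  step = +-cancelʳ-≤ 5 _ _ (subst (_≤ 5 * k + 5) (unfold j d) small)
  small′ : 12 * (j + d) ≤ 5 * k + 5
  small′ = ≤-trans (m≤m+n _ 7) (≤-trans step (m≤m+n _ 5))

binomial-≤-2^ : ∀ k r → binomial k r ≤ 2 ^ k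
binomial-≤-2^ k       zero    = m^n>0 2 k
binomial-≤-2^ zero    (suc r) = z≤n
binomial-≤-2^ (suc k) (suc r) = +-mono-≤ (binomial-≤-2^ k r) (≤-trans (binomial-≤-2^ k (suc r)) (m≤m+n _ 0))

binomial-1 : ∀ k → binomial k 1 ≡ k
binomial-1 zero    = refl
binomial-1 (suc k) = cong suc (binomial-1 k)

^-distribʳ-* : ∀ m n o → (m * n) ^ o ≡ m ^ o * n ^ o
^-distribʳ-* m n zero    = refl
^-distribʳ-* m n (suc o) = trans (cong (m * n *_) (^-distribʳ-* m n o)) (regroup m n (m ^ o) (n ^ o))
  where
  regroup : ∀ m n x y → m * n * (x * y) ≡ m * x * (n * y)
  regroup = solve-∀

-- M·T ≤ 2nT/N, so the condition reduces to n·(2T/N)^q ≤ 1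
dimension-bound : ∀ q n M N T X .{{_ : NonZero N}} → M * N ≤ 2 * n → n ≤ X →
                  X * (2 * T) ^ q ≤ N ^ q → (M * T) ^ q * n ≤ n ^ q
dimension-bound q n M N T X MN≤2n n≤X key = *-cancelʳ-≤ _ _ (N ^ q) {{m^n≢0 N q}} (begin
  (M * T) ^ q * n * N ^ q       ≡⟨ cong (λ u → u * n * N ^ q) (^-distribʳ-* M T q) ⟩
  M ^ q * T ^ q * n * N ^ q     ≡⟨ regroup (M ^ q) (T ^ q) n (N ^ q) ⟩
  M ^ q * N ^ q * T ^ q * n     ≡⟨ cong (λ u → u * T ^ q * n) (^-distribʳ-* M N q) ⟨
  (M * N) ^ q * T ^ q * n       ≤⟨ *-monoˡ-≤ n (*-monoˡ-≤ (T ^ q) (^-monoˡ-≤ q MN≤2n)) ⟩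
  (2 * n) ^ q * T ^ q * n       ≡⟨ cong (λ u → u * T ^ q * n) (^-distribʳ-* 2 n q) ⟩
  2 ^ q * n ^ q * T ^ q * n     ≡⟨ regroup′ (2 ^ q) (n ^ q) (T ^ q) n ⟩
  n ^ q * (2 ^ q * T ^ q * n)   ≡⟨ cong (λ u → n ^ q * (u * n)) (^-distribʳ-* 2 T q) ⟨
  n ^ q * ((2 * T) ^ q * n)     ≤⟨ *-monoʳ-≤ (n ^ q) (*-monoʳ-≤ ((2 * T) ^ q) n≤X) ⟩
  n ^ q * ((2 * T) ^ q * X)     ≡⟨ cong (n ^ q *_) (*-comm ((2 * T) ^ q) X) ⟩
  n ^ q * (X * (2 * T) ^ q)     ≤⟨ *-monoʳ-≤ (n ^ q) key ⟩
  n ^ q * N ^ q                 ∎)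
  where
  open ≤-Reasoning
  regroup : ∀ m t n u → m * t * n * u ≡ m * u * t * n
  regroup = solve-∀
  regroup′ : ∀ c m t n → c * m * t * n ≡ m * (c * t * n)
  regroup′ = solve-∀

n≤suc[n/N]*N≤2n : ∀ n N .{{_ : NonZero N}} → N ≤ n → n ≤ suc (n / N) * N × suc (n / N) * N ≤ 2 * n
n≤suc[n/N]*N≤2n n N N≤n =
  <⇒≤ (subst (_< suc (n / N) * N) (sym (m≡m%n+[m/n]*n n N)) (+-monoˡ-< (n / N * N) (m%n<n n N))) ,
  (begin
    N + n / N * N   ≤⟨ +-mono-≤ N≤n (m/n*n≤m n N) ⟩
    n + n           ≡⟨ cong (n +_) (+-identityʳ n) ⟨
    2 * n           ∎)
  where open ≤-Reasoning

growth : ∀ h → 2 ^ (24 * h) * 2 ^ (24 * h) * (5 ^ h) ^ 100 ≤ (7 ^ h) ^ 100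
growth h = begin
  2 ^ (24 * h) * 2 ^ (24 * h) * (5 ^ h) ^ 100
    ≡⟨ cong (_* (5 ^ h) ^ 100) (^-distribˡ-+-* 2 (24 * h) (24 * h)) ⟨
  2 ^ (24 * h + 24 * h) * (5 ^ h) ^ 100
    ≡⟨ cong₂ _*_ (trans (cong (2 ^_) (48h h)) (sym (^-*-assoc 2 48 h))) (swap 5) ⟩
  (2 ^ 48) ^ h * (5 ^ 100) ^ h
    ≡⟨ ^-distribʳ-* (2 ^ 48) (5 ^ 100) h ⟨
  (2 ^ 48 * 5 ^ 100) ^ h
    ≤⟨ ^-monoˡ-≤ h (≤ᵇ⇒≤ (2 ^ 48 * 5 ^ 100) (7 ^ 100) _) ⟩
  (7 ^ 100) ^ h
    ≡⟨ swap 7 ⟨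
  (7 ^ h) ^ 100 ∎
  where
  open ≤-Reasoning
  48h : ∀ h → 24 * h + 24 * h ≡ 48 * h
  48h = solve-∀
  swap : ∀ m → (m ^ h) ^ 100 ≡ (m ^ 100) ^ h
  swap m = trans (^-*-assoc m h 100) (trans (cong (m ^_) (*-comm h 100)) (sym (^-*-assoc m 100 h)))

mersenne-mono : ∀ {s s′} → s ≤ s′ → mersenne s ≤ mersenne s′
mersenne-mono z≤n       = z≤n
mersenne-mono (s≤s s≤s′) = s≤s (+-mono-≤ (mersenne-mono s≤s′) (mersenne-mono s≤s′))

n≤mersenne : ∀ s → s ≤ mersenne s
n≤mersenne zero    = z≤n
n≤mersenne (suc s) = s≤s (≤-trans (n≤mersenne s) (m≤m+n _ _))

-- a = 2^(s+1) − 1, so H = 2h with h = 2^s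
module Level (s : ℕ) where

  h a : ℕ
  h = suc (mersenne s)
  a = mersenne (suc s)

  open Construction a public

  C : ℕ
  C = binomial k (a + H)

  a+H+h≤w : a + H + h ≤ w
  a+H+h≤w = begin
    a + H + h     ≡⟨ +-assoc a H h ⟩
    a + (H + h)   ≤⟨ +-monoʳ-≤ a (+-monoʳ-≤ H (s≤s (≤-trans (m≤m+n _ _) (n≤1+n _)))) ⟩
    a + (H + H)   ∎
    where open ≤-Reasoning

  T≤2C : T ≤ 2 * C
  T≤2C = begin
    binomial k a + C  ≤⟨ +-monoˡ-≤ C (binomial-monoʳ-≤ k (m≤m+n a H) 2[a+H]<k) ⟩
    C + C             ≡⟨ cong (C +_) (+-identityʳ C) ⟨
    2 * C             ∎
    where
    open ≤-Reasoning
    2[a+H]<k : 2 * (a + H) < k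
    2[a+H]<k = ≤-<-trans (*-monoʳ-≤ 2 (≤-trans (m≤m+n (a + H) h) a+H+h≤w)) 2w<k

  7^h*C≤5^h*N : 7 ^ h * C ≤ 5 ^ h * N
  7^h*C≤5^h*N = begin
    7 ^ h * C
      ≤⟨ binomial-ratio k (a + H) h (≤-trans (m≤m+n _ 12) (≤-reflexive (room (mersenne s)))) ⟩
    5 ^ h * binomial k (a + H + h)
      ≤⟨ *-monoʳ-≤ (5 ^ h) (binomial-monoʳ-≤ k a+H+h≤w 2w<k) ⟩
    5 ^ h * N ∎
    where
    open ≤-Reasoning
    room : ∀ b → let h = suc b; a = suc (b + b); H = suc a; w = a + (H + H) in
           12 * (a + H + h) + 12 ≡ 5 * (w + (H + (H + H))) + 5
    room = solve-∀

  2T*7^h≤4*5^h*N : 2 * T * 7 ^ h ≤ 4 * (5 ^ h * N)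
  2T*7^h≤4*5^h*N = begin
    2 * T * 7 ^ h         ≤⟨ *-monoˡ-≤ (7 ^ h) (*-monoʳ-≤ 2 T≤2C) ⟩
    2 * (2 * C) * 7 ^ h   ≡⟨ regroup C (7 ^ h) ⟩
    4 * (7 ^ h * C)       ≤⟨ *-monoʳ-≤ 4 7^h*C≤5^h*N ⟩
    4 * (5 ^ h * N)       ∎
    where
    open ≤-Reasoning
    regroup : ∀ c x → 2 * (2 * c) * x ≡ 4 * (x * c)
    regroup = solve-∀

  -- 2^(24h) bounds the next vertex count (N-suc≤); the factor (5/7)^h of 7^h*C≤5^h*N beats it
  -- in the 100th power because 2^48 · 5^100 ≤ 7^100 (growth).
  dimension-gap : 9 ≤ h → 2 ^ (24 * h) * (2 * T) ^ 100 ≤ N ^ 100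
  dimension-gap 9≤h = *-cancelʳ-≤ _ _ ((7 ^ h) ^ 100) {{m^n≢0 (7 ^ h) 100 {{m^n≢0 7 h}}}} (begin
    2 ^ (24 * h) * (2 * T) ^ 100 * (7 ^ h) ^ 100
      ≡⟨ trans (cong (2 ^ (24 * h) *_) (^-distribʳ-* (2 * T) (7 ^ h) 100))
               (sym (*-assoc (2 ^ (24 * h)) ((2 * T) ^ 100) ((7 ^ h) ^ 100))) ⟨
    2 ^ (24 * h) * (2 * T * 7 ^ h) ^ 100
      ≤⟨ *-monoʳ-≤ (2 ^ (24 * h)) (^-monoˡ-≤ 100 2T*7^h≤4*5^h*N) ⟩
    2 ^ (24 * h) * (4 * (5 ^ h * N)) ^ 100
      ≡⟨ cong (2 ^ (24 * h) *_) (trans (^-distribʳ-* 4 (5 ^ h * N) 100)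
                                       (cong (4 ^ 100 *_) (^-distribʳ-* (5 ^ h) N 100))) ⟩
    2 ^ (24 * h) * (4 ^ 100 * ((5 ^ h) ^ 100 * N ^ 100))
      ≡⟨ regroup (2 ^ (24 * h)) (4 ^ 100) ((5 ^ h) ^ 100) (N ^ 100) ⟩
    2 ^ (24 * h) * 4 ^ 100 * (5 ^ h) ^ 100 * N ^ 100
      ≤⟨ *-monoˡ-≤ (N ^ 100) (*-monoˡ-≤ ((5 ^ h) ^ 100) (*-monoʳ-≤ (2 ^ (24 * h)) 4^100≤2^24h)) ⟩
    2 ^ (24 * h) * 2 ^ (24 * h) * (5 ^ h) ^ 100 * N ^ 100
      ≤⟨ *-monoˡ-≤ (N ^ 100) (growth h) ⟩
    (7 ^ h) ^ 100 * N ^ 100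
      ≡⟨ *-comm ((7 ^ h) ^ 100) (N ^ 100) ⟩
    N ^ 100 * (7 ^ h) ^ 100 ∎)
    where
    open ≤-Reasoning
    regroup : ∀ x y z u → x * (y * (z * u)) ≡ x * y * z * u
    regroup = solve-∀
    4^100≤2^24h : 4 ^ 100 ≤ 2 ^ (24 * h)
    4^100≤2^24h = ^-monoʳ-≤ 2 (≤-trans (≤ᵇ⇒≤ 200 216 _) (*-monoʳ-≤ 24 9≤h))

  s<N : s < N
  s<N = begin-strict
    s              ≤⟨ n≤mersenne s ⟩
    mersenne s     <⟨ s≤s (m≤m+n _ _) ⟩
    a              ≤⟨ m≤m+n a _ ⟩
    w              ≤⟨ m≤m+n w _ ⟩
    k              ≡⟨ binomial-1 k ⟨
    binomial k 1   ≤⟨ binomial-monoʳ-≤ k (s≤s z≤n) 2w<k ⟩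
    N              ∎
    where open ≤-Reasoning

N-suc≤ : ∀ s → Level.N (suc s) ≤ 2 ^ (24 * Level.h s)
N-suc≤ s = ≤-trans (binomial-≤-2^ (Level.k (suc s)) (Level.w (suc s)))
                   (^-monoʳ-≤ 2 (<⇒≤ (≤-reflexive (room (mersenne s)))))
  where
  room : ∀ b → let a = suc (suc (b + b) + suc (b + b)); H = suc a; w = a + (H + H) in
         suc (w + (H + (H + H))) ≡ 24 * suc b
  room = solve-∀

bracket : (f : ℕ → ℕ) → (∀ s → s < f s) → ∀ {s₀ n} → f s₀ ≤ n →
          ∃[ s ] (s₀ ≤ s × f s ≤ n × n < f (suc s))
bracket f s<f {s₀} {n} f₀≤n = search n s₀ ≤-refl f₀≤n (m≤n+m n s₀)
  where
  search : ∀ d s → s₀ ≤ s → f s ≤ n → n ≤ s + d → ∃[ s′ ] (s₀ ≤ s′ × f s′ ≤ n × n < f (suc s′))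
  search d s s₀≤s fs≤n n≤s+d with f (suc s) ≤? n
  search d       s s₀≤s fs≤n n≤s+d | no  f′≰n = s , s₀≤s , fs≤n , ≰⇒> f′≰n
  search zero    s s₀≤s fs≤n n≤s+d | yes f′≤n =
    contradiction (<-trans (n<1+n s) (<-≤-trans (s<f (suc s)) f′≤n)) (≤⇒≯ (subst (n ≤_) (+-identityʳ s) n≤s+d))
  search (suc d) s s₀≤s fs≤n n≤s+d | yes f′≤n =
    search d (suc s) (m≤n⇒m≤1+n s₀≤s) f′≤n (subst (n ≤_) (+-suc s d) n≤s+d)

graph-between-levels : ∀ s → 4 ≤ s → ∀ n → Level.N s ≤ n → n < Level.N (suc s) →
                       Σ (Graph n) λ G → TriangleFree G × ξ-F2-≤-pow (complement G) 1 100
graph-between-levels s 4≤s n N≤n n<N′ =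
  let G , tf , ρ = subgraphOfCopies {G = graph} n M n≤MN graph-triangleFree (graph-orthRep (Frobenius-mersenne (suc s)))
  in  G , tf , M * T , ρ , subst (λ x → (M * T) ^ 100 * x ≤ n ^ 100) (sym (*-identityʳ n)) bound
  where
  open Level s
  instance
    N≢0 : NonZero N
    N≢0 = >-nonZero (<-≤-trans z<s s<N)
  M : ℕ
  M = suc (n / N)
  n≤MN : n ≤ M * N
  n≤MN = proj₁ (n≤suc[n/N]*N≤2n n N N≤n)
  MN≤2n : M * N ≤ 2 * n
  MN≤2n = proj₂ (n≤suc[n/N]*N≤2n n N N≤n)
  9≤h : 9 ≤ h
  9≤h = s≤s (≤-trans (≤ᵇ⇒≤ 8 15 _) (mersenne-mono 4≤s))
  bound : (M * T) ^ 100 * n ≤ n ^ 100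
  bound = dimension-bound 100 n M N T (2 ^ (24 * h)) MN≤2n (≤-trans (<⇒≤ n<N′) (N-suc≤ s)) (dimension-gap 9≤h)

large-graph : ∀ s₀ → 4 ≤ s₀ → ∀ n → Level.N s₀ ≤ n →
              Σ (Graph n) λ G → TriangleFree G × ξ-F2-≤-pow (complement G) 1 100
large-graph s₀ 4≤s₀ n N≤n =
  let s , s₀≤s , N≤n , n<N′ = bracket Level.N Level.s<N {s₀} N≤n
  in  graph-between-levels s (≤-trans 4≤s₀ s₀≤s) n N≤n n<N′

theorem1p11 : ∃[ p ] ∃[ q ] (0 < p × 0 < q × ∃[ N ] (∀ n → N ≤ n → Σ (Graph n) λ G → TriangleFree G × ξ-F2-≤-pow (complement G) p q))
theorem1p11 = 1 , 100 , z<s , z<s , _ , large-graph 4 ≤-refl
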